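{- Let $\overrightarrow{G_1},\dots,\overrightarrow{G_k}$ be pairwise vertex-disjoint oriented graphs such that $\overrightarrow{G_1}$ is a DDMOG and, for each $2\le i\le k$, $\overrightarrow{G_i}$ is a DDMOG with $imb(\overrightarrow{G_i})=0$. Then the oriented graph $\overrightarrow{G}=\bigcup_{i=1}^k\overrightarrow{G_i}$ is a DDMOG.
   Context: An oriented graph is a digraph with no loops, no multiple arcs, and such that $(u,v)$ being an arc implies $(v,u)$ is not an arc. $N^+(v)$ is the set of $u$ with $(u,v)$ an arc, $N^-(v)$ the set of $u$ with $(v,u)$ an arc; $imb(v)=|N^+(v)|-|N^-(v)|$ and $imb(D)=\max_{v}|imb(v)|$. For a labeling $f$, $wt_f(v)=\sum_{u\in N^+(v)} f(u) - \sum_{u \in N^-(v)} f(u)$. A DDMOG (difference distance magic oriented graph) on $n$ vertices is an oriented graph admitting a bijection $f:V\to\{1,\dots,n\}$ with $wt_f(v)=0$ for all $v$. -}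

module Defs where

open import Data.Nat using (ℕ; zero; suc; _+_)
open import Data.Fin using (Fin; toℕ; splitAt)
open import Data.Bool using (Bool; true; false; if_then_else_)
open import Data.Sum using (_⊎_; inj₁; inj₂)
open import Data.Product using (Σ; _×_; _,_; ∃)
open import Data.Integer using (ℤ; +_; _-_)
open import Data.List using (List; []; _∷_)
open import Data.List.Relation.Unary.All using (All)
open import Data.Empty using (⊥)
open import Relation.Binary.PropositionalEquality using (_≡_)
open import Function.Definitions using (Bijective)

record Digraph : Set where
  field
    n   : ℕ
    arc : Fin n → Fin n → Bool
open Digraph public

-- Oriented: no loops and (u,v) arc implies (v,u) not an arc.
-- (No multiple arcs is automatic with a Bool-valued arc relation.)
IsOriented : Digraph → Set
IsOriented D = (∀ v → arc D v v ≡ false)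
             × (∀ u v → arc D u v ≡ true → arc D v u ≡ false)

sumFin : (n : ℕ) → (Fin n → ℤ) → ℤ
sumFin zero    g = + 0
sumFin (suc n) g = g Fin.zero Data.Integer.+ sumFin n (λ i → g (Fin.suc i))
  where import Data.Fin as Fin

-- wt_f(v) = Σ_{u ∈ N⁺(v)} f(u) − Σ_{u ∈ N⁻(v)} f(u)
-- N⁺(v) = {u | (u,v) arc},  N⁻(v) = {u | (v,u) arc}
wt : (D : Digraph) → (Fin (n D) → ℕ) → Fin (n D) → ℤ
wt D f v = sumFin (n D) (λ u → if arc D u v then + f u else + 0)
         - sumFin (n D) (λ u → if arc D v u then + f u else + 0)

imbV : (D : Digraph) → Fin (n D) → ℤ
imbV D v = wt D (λ _ → 1) v

-- imb(D) = max_v |imb(v)| = 0  iff  every imb(v) = 0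
ImbZero : Digraph → Set
ImbZero D = ∀ v → imbV D v ≡ + 0

-- A labeling f : V → {1,…,n} bijective is f v = 1 + σ v with σ : Fin n → Fin n bijective.
IsDDMLabeling : (D : Digraph) → (Fin (n D) → Fin (n D)) → Set
IsDDMLabeling D σ = Bijective _≡_ _≡_ σ
                  × (∀ v → wt D (λ u → suc (toℕ (σ u))) v ≡ + 0)

DDMOG : Digraph → Set
DDMOG D = IsOriented D × ∃ (λ σ → IsDDMLabeling D σ)

unionArc : {m k : ℕ} → (Fin m → Fin m → Bool) → (Fin k → Fin k → Bool)
         → Fin m ⊎ Fin k → Fin m ⊎ Fin k → Bool
unionArc a b (inj₁ i) (inj₁ j) = a i j
unionArc a b (inj₂ i) (inj₂ j) = b i j
unionArc a b (inj₁ _) (inj₂ _) = false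
unionArc a b (inj₂ _) (inj₁ _) = false

_⊕_ : Digraph → Digraph → Digraph
G ⊕ H = record
  { n   = n G + n H
  ; arc = λ x y → unionArc (arc G) (arc H) (splitAt (n G) x) (splitAt (n G) y) }

bigUnion : Digraph → List Digraph → Digraph
bigUnion G []       = G
bigUnion G (H ∷ Hs) = bigUnion (G ⊕ H) Hs

-- Relabel each later block Gᵢ by adding the number of vertices before it. Since Gᵢ is
-- balanced (in-degree = out-degree everywhere), adding a constant m to every label
-- changes each weight by m · imb(v) = 0; and no arcs join different blocks, so the
-- weights of the union are those of its blocks.
module Submission where

open import Defs
open import Data.Product using (_×_; _,_)
open import Data.List using (List; []; _∷_)
open import Data.List.Relation.Unary.All using (All; []; _∷_)

open import Data.Nat as ℕ using (ℕ; zero; suc)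
open import Data.Nat.Properties as ℕ using ()
open import Data.Fin as Fin using (Fin; toℕ; splitAt; join; _↑ˡ_; _↑ʳ_)
open import Data.Fin.Properties
  using (splitAt-↑ˡ; splitAt-↑ʳ; splitAt⁻¹-↑ˡ; splitAt⁻¹-↑ʳ; toℕ-↑ˡ; toℕ-↑ʳ; +↔⊎)
open import Data.Bool using (Bool; true; false; if_then_else_)
open import Data.Sum as Sum using (inj₁; inj₂)
open import Data.Sum.Properties using (inj₁-injective; inj₂-injective)
open import Data.Integer as ℤ using (ℤ; +_; _-_; _+_; _*_)
open import Data.Integer.Properties as ℤ using ()
open import Data.Integer.Tactic.RingSolver using (solve-∀)
open import Function.Base using (_∘_)
open import Function.Bundles using (Bijection)
open import Function.Definitions using (Bijective; Injective; Surjective)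
open import Function.Properties.Inverse using (↔⇒⤖; ↔-sym)
import Function.Construct.Composition as Compose
open import Relation.Binary.PropositionalEquality

sumFin-cong : ∀ n {g h : Fin n → ℤ} → (∀ i → g i ≡ h i) → sumFin n g ≡ sumFin n h
sumFin-cong zero    g≗h = refl
sumFin-cong (suc n) g≗h = cong₂ _+_ (g≗h Fin.zero) (sumFin-cong n (g≗h ∘ Fin.suc))

sumFin-split : ∀ m k (g : Fin (m ℕ.+ k) → ℤ) →
  sumFin (m ℕ.+ k) g ≡ sumFin m (g ∘ (_↑ˡ k)) + sumFin k (g ∘ (m ↑ʳ_))
sumFin-split zero    k g = sym (ℤ.+-identityˡ _)
sumFin-split (suc m) k g = trans (cong (λ s → g Fin.zero + s) (sumFin-split m k (g ∘ Fin.suc)))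
                                 (sym (ℤ.+-assoc (g Fin.zero) _ _))

↑-elim : ∀ {m k} {P : Fin (m ℕ.+ k) → Set} →
  (∀ i → P (i ↑ˡ k)) → (∀ j → P (m ↑ʳ j)) → ∀ v → P v
↑-elim {m} {P = P} left right v with splitAt m v in eq
... | inj₁ i = subst P (splitAt⁻¹-↑ˡ eq) (left i)
... | inj₂ j = subst P (splitAt⁻¹-↑ʳ eq) (right j)

sumOn : ∀ n → (Fin n → Bool) → (Fin n → ℕ) → ℤ
sumOn n a f = sumFin n (λ u → if a u then + f u else + 0)

sumOn-cong : ∀ n {a b : Fin n → Bool} {f g : Fin n → ℕ} →
  (∀ u → a u ≡ b u) → (∀ u → f u ≡ g u) → sumOn n a f ≡ sumOn n b g
sumOn-cong n a≗b f≗g = sumFin-cong n (λ u → cong₂ (λ c x → if c then + x else + 0) (a≗b u) (f≗g u))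

sumOn-none : ∀ n {a : Fin n → Bool} (f : Fin n → ℕ) → (∀ u → a u ≡ false) → sumOn n a f ≡ + 0
sumOn-none zero    f none = refl
sumOn-none (suc n) f none rewrite none Fin.zero = trans (ℤ.+-identityˡ _) (sumOn-none n (f ∘ Fin.suc) (none ∘ Fin.suc))

sumOn-↑ˡ : ∀ m k (a : Fin (m ℕ.+ k) → Bool) f → (∀ u → a (m ↑ʳ u) ≡ false) →
  sumOn (m ℕ.+ k) a f ≡ sumOn m (a ∘ (_↑ˡ k)) (f ∘ (_↑ˡ k))
sumOn-↑ˡ m k a f none = begin
  sumOn (m ℕ.+ k) a f                                                    ≡⟨ sumFin-split m k _ ⟩
  sumOn m (a ∘ (_↑ˡ k)) (f ∘ (_↑ˡ k)) + sumOn k (a ∘ (m ↑ʳ_)) (f ∘ (m ↑ʳ_)) ≡⟨ cong (λ s → sumOn m _ _ + s) (sumOn-none k _ none) ⟩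
  sumOn m (a ∘ (_↑ˡ k)) (f ∘ (_↑ˡ k)) + + 0                               ≡⟨ ℤ.+-identityʳ _ ⟩
  sumOn m (a ∘ (_↑ˡ k)) (f ∘ (_↑ˡ k))                                     ∎
  where open ≡-Reasoning

sumOn-↑ʳ : ∀ m k (a : Fin (m ℕ.+ k) → Bool) f → (∀ u → a (u ↑ˡ k) ≡ false) →
  sumOn (m ℕ.+ k) a f ≡ sumOn k (a ∘ (m ↑ʳ_)) (f ∘ (m ↑ʳ_))
sumOn-↑ʳ m k a f none = begin
  sumOn (m ℕ.+ k) a f                                                    ≡⟨ sumFin-split m k _ ⟩
  sumOn m (a ∘ (_↑ˡ k)) (f ∘ (_↑ˡ k)) + sumOn k (a ∘ (m ↑ʳ_)) (f ∘ (m ↑ʳ_)) ≡⟨ cong (_+ sumOn k _ _) (sumOn-none m _ none) ⟩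
  + 0 + sumOn k (a ∘ (m ↑ʳ_)) (f ∘ (m ↑ʳ_))                               ≡⟨ ℤ.+-identityˡ _ ⟩
  sumOn k (a ∘ (m ↑ʳ_)) (f ∘ (m ↑ʳ_))                                     ∎
  where open ≡-Reasoning

sumOn-shift : ∀ n (a : Fin n → Bool) m f →
  sumOn n a (λ u → m ℕ.+ f u) ≡ + m * sumOn n a (λ _ → 1) + sumOn n a f
sumOn-shift zero    a m f = sym (cong (_+ + 0) (ℤ.*-zeroʳ (+ m)))
sumOn-shift (suc n) a m f with a Fin.zero
... | true  = begin
  + (m ℕ.+ f Fin.zero) + sumOn n a′ (λ u → m ℕ.+ f′ u)
    ≡⟨ cong₂ _+_ (ℤ.pos-+ m (f Fin.zero)) (sumOn-shift n a′ m f′) ⟩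
  (+ m + + f Fin.zero) + (+ m * sumOn n a′ (λ _ → 1) + sumOn n a′ f′)
    ≡⟨ regroup (+ m) (+ f Fin.zero) _ _ ⟩
  + m * (+ 1 + sumOn n a′ (λ _ → 1)) + (+ f Fin.zero + sumOn n a′ f′) ∎
  where
  open ≡-Reasoning
  a′ = a ∘ Fin.suc
  f′ = f ∘ Fin.suc
  regroup : ∀ c x s t → (c + x) + (c * s + t) ≡ c * (+ 1 + s) + (x + t)
  regroup = solve-∀
... | false = begin
  + 0 + sumOn n a′ (λ u → m ℕ.+ f′ u)                         ≡⟨ cong (λ s → + 0 + s) (sumOn-shift n a′ m f′) ⟩
  + 0 + (+ m * sumOn n a′ (λ _ → 1) + sumOn n a′ f′)           ≡⟨ regroup (+ m) _ _ ⟩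
  + m * (+ 0 + sumOn n a′ (λ _ → 1)) + (+ 0 + sumOn n a′ f′)   ∎
  where
  open ≡-Reasoning
  a′ = a ∘ Fin.suc
  f′ = f ∘ Fin.suc
  regroup : ∀ c s t → + 0 + (c * s + t) ≡ c * (+ 0 + s) + (+ 0 + t)
  regroup = solve-∀

wt-cong : ∀ D {f g : Fin (n D) → ℕ} → (∀ u → f u ≡ g u) → ∀ v → wt D f v ≡ wt D g v
wt-cong D f≗g v = cong₂ _-_ (sumOn-cong (n D) (λ _ → refl) f≗g) (sumOn-cong (n D) (λ _ → refl) f≗g)

wt-shift : ∀ D m (f : Fin (n D) → ℕ) v →
  wt D (λ u → m ℕ.+ f u) v ≡ + m * imbV D v + wt D f v
wt-shift D m f v =
  trans (cong₂ _-_ (sumOn-shift (n D) (λ u → arc D u v) m f) (sumOn-shift (n D) (λ u → arc D v u) m f))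
        (regroup (+ m) _ _ _ _)
  where
  regroup : ∀ c s x t y → (c * s + x) - (c * t + y) ≡ c * (s - t) + (x - y)
  regroup = solve-∀

wt-shift-balanced : ∀ D → ImbZero D → ∀ m (f : Fin (n D) → ℕ) v →
  wt D (λ u → m ℕ.+ f u) v ≡ wt D f v
wt-shift-balanced D balanced m f v = begin
  wt D (λ u → m ℕ.+ f u) v     ≡⟨ wt-shift D m f v ⟩
  + m * imbV D v + wt D f v    ≡⟨ cong (λ i → + m * i + wt D f v) (balanced v) ⟩
  + m * + 0 + wt D f v         ≡⟨ cong (_+ wt D f v) (ℤ.*-zeroʳ (+ m)) ⟩
  + 0 + wt D f v               ≡⟨ ℤ.+-identityˡ _ ⟩
  wt D f v                     ∎
  where open ≡-Reasoning

module _ (G H : Digraph) where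

  private
    m = n G
    k = n H

  arc-⊕-↑ˡ↑ˡ : ∀ u v → arc (G ⊕ H) (u ↑ˡ k) (v ↑ˡ k) ≡ arc G u v
  arc-⊕-↑ˡ↑ˡ u v rewrite splitAt-↑ˡ m u k | splitAt-↑ˡ m v k = refl

  arc-⊕-↑ʳ↑ʳ : ∀ u v → arc (G ⊕ H) (m ↑ʳ u) (m ↑ʳ v) ≡ arc H u v
  arc-⊕-↑ʳ↑ʳ u v rewrite splitAt-↑ʳ m k u | splitAt-↑ʳ m k v = refl

  arc-⊕-↑ˡ↑ʳ : ∀ u v → arc (G ⊕ H) (u ↑ˡ k) (m ↑ʳ v) ≡ false
  arc-⊕-↑ˡ↑ʳ u v rewrite splitAt-↑ˡ m u k | splitAt-↑ʳ m k v = refl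

  arc-⊕-↑ʳ↑ˡ : ∀ u v → arc (G ⊕ H) (m ↑ʳ u) (v ↑ˡ k) ≡ false
  arc-⊕-↑ʳ↑ˡ u v rewrite splitAt-↑ʳ m k u | splitAt-↑ˡ m v k = refl

  wt-⊕-↑ˡ : ∀ f i → wt (G ⊕ H) f (i ↑ˡ k) ≡ wt G (f ∘ (_↑ˡ k)) i
  wt-⊕-↑ˡ f i = cong₂ _-_
    (trans (sumOn-↑ˡ m k _ f (λ u → arc-⊕-↑ʳ↑ˡ u i))
           (sumOn-cong m (λ u → arc-⊕-↑ˡ↑ˡ u i) (λ _ → refl)))
    (trans (sumOn-↑ˡ m k _ f (arc-⊕-↑ˡ↑ʳ i))
           (sumOn-cong m (arc-⊕-↑ˡ↑ˡ i) (λ _ → refl)))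

  wt-⊕-↑ʳ : ∀ f j → wt (G ⊕ H) f (m ↑ʳ j) ≡ wt H (f ∘ (m ↑ʳ_)) j
  wt-⊕-↑ʳ f j = cong₂ _-_
    (trans (sumOn-↑ʳ m k _ f (λ u → arc-⊕-↑ˡ↑ʳ u j))
           (sumOn-cong k (λ u → arc-⊕-↑ʳ↑ʳ u j) (λ _ → refl)))
    (trans (sumOn-↑ʳ m k _ f (arc-⊕-↑ʳ↑ˡ j))
           (sumOn-cong k (arc-⊕-↑ʳ↑ʳ j) (λ _ → refl)))

⊕-isOriented : ∀ G H → IsOriented G → IsOriented H → IsOriented (G ⊕ H)
⊕-isOriented G H (loopless-G , asym-G) (loopless-H , asym-H) = loopless , asym
  where
  loopless : ∀ v → arc (G ⊕ H) v v ≡ false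
  loopless = ↑-elim (λ i → trans (arc-⊕-↑ˡ↑ˡ G H i i) (loopless-G i))
                    (λ j → trans (arc-⊕-↑ʳ↑ʳ G H j j) (loopless-H j))
  asym : ∀ u v → arc (G ⊕ H) u v ≡ true → arc (G ⊕ H) v u ≡ false
  asym = ↑-elim (λ i → ↑-elim (asym-left i) (λ j _ → arc-⊕-↑ʳ↑ˡ G H j i))
                (λ i → ↑-elim (λ j _ → arc-⊕-↑ˡ↑ʳ G H j i) (asym-right i))
    where
    asym-left : ∀ i j → arc (G ⊕ H) (i ↑ˡ n H) (j ↑ˡ n H) ≡ true → arc (G ⊕ H) (j ↑ˡ n H) (i ↑ˡ n H) ≡ false
    asym-left i j e = trans (arc-⊕-↑ˡ↑ˡ G H j i) (asym-G i j (trans (sym (arc-⊕-↑ˡ↑ˡ G H i j)) e))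
    asym-right : ∀ i j → arc (G ⊕ H) (n G ↑ʳ i) (n G ↑ʳ j) ≡ true → arc (G ⊕ H) (n G ↑ʳ j) (n G ↑ʳ i) ≡ false
    asym-right i j e = trans (arc-⊕-↑ʳ↑ʳ G H j i) (asym-H i j (trans (sym (arc-⊕-↑ʳ↑ʳ G H i j)) e))

map-bijective : ∀ {A B C D : Set} {f : A → B} {g : C → D} →
  Bijective _≡_ _≡_ f → Bijective _≡_ _≡_ g → Bijective _≡_ _≡_ (Sum.map f g)
map-bijective {f = f} {g} (f-inj , f-surj) (g-inj , g-surj) = injective , surjective
  where
  injective : Injective _≡_ _≡_ (Sum.map f g)
  injective {inj₁ x} {inj₁ y} e = cong inj₁ (f-inj (inj₁-injective e))
  injective {inj₂ x} {inj₂ y} e = cong inj₂ (g-inj (inj₂-injective e))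
  injective {inj₁ x} {inj₂ y} ()
  injective {inj₂ x} {inj₁ y} ()
  surjective : Surjective _≡_ _≡_ (Sum.map f g)
  surjective (inj₁ y) = let x , fx≡y = f-surj y in inj₁ x , λ { refl → cong inj₁ (fx≡y refl) }
  surjective (inj₂ y) = let x , gx≡y = g-surj y in inj₂ x , λ { refl → cong inj₂ (gx≡y refl) }

blockwise : ∀ {m m′ k k′} → (Fin m → Fin m′) → (Fin k → Fin k′) → Fin (m ℕ.+ k) → Fin (m′ ℕ.+ k′)
blockwise {m} {m′} {k} {k′} σ τ = join m′ k′ ∘ Sum.map σ τ ∘ splitAt m

blockwise-bijective : ∀ {m m′ k k′} {σ : Fin m → Fin m′} {τ : Fin k → Fin k′} →
  Bijective _≡_ _≡_ σ → Bijective _≡_ _≡_ τ → Bijective _≡_ _≡_ (blockwise σ τ)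
blockwise-bijective {m} {m′} {k} {k′} σ-bij τ-bij =
  Compose.bijective _≡_ _≡_ _≡_
    (Compose.bijective _≡_ _≡_ _≡_ (Bijection.bijective (↔⇒⤖ (+↔⊎ {m} {k}))) (map-bijective σ-bij τ-bij))
    (Bijection.bijective (↔⇒⤖ (↔-sym (+↔⊎ {m′} {k′}))))

toℕ-blockwise-↑ˡ : ∀ {m m′ k k′} (σ : Fin m → Fin m′) (τ : Fin k → Fin k′) i →
  toℕ (blockwise σ τ (i ↑ˡ k)) ≡ toℕ (σ i)
toℕ-blockwise-↑ˡ {m} {m′} {k} {k′} σ τ i rewrite splitAt-↑ˡ m i k = toℕ-↑ˡ (σ i) k′

toℕ-blockwise-↑ʳ : ∀ {m m′ k k′} (σ : Fin m → Fin m′) (τ : Fin k → Fin k′) j →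
  toℕ (blockwise σ τ (m ↑ʳ j)) ≡ m′ ℕ.+ toℕ (τ j)
toℕ-blockwise-↑ʳ {m} {m′} {k} σ τ j rewrite splitAt-↑ʳ m k j = toℕ-↑ʳ m′ (τ j)

⊕-DDMOG : ∀ G H → DDMOG G → DDMOG H → ImbZero H → DDMOG (G ⊕ H)
⊕-DDMOG G H (G-oriented , σ , σ-bij , wt-σ) (H-oriented , τ , τ-bij , wt-τ) balanced =
  ⊕-isOriented G H G-oriented H-oriented , ρ , blockwise-bijective σ-bij τ-bij , ↑-elim wt-left wt-right
  where
  m = n G
  k = n H
  ρ : Fin (m ℕ.+ k) → Fin (m ℕ.+ k)
  ρ = blockwise σ τ
  label : Fin (m ℕ.+ k) → ℕ
  label u = suc (toℕ (ρ u))
  open ≡-Reasoning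

  wt-left : ∀ i → wt (G ⊕ H) label (i ↑ˡ k) ≡ + 0
  wt-left i = begin
    wt (G ⊕ H) label (i ↑ˡ k)       ≡⟨ wt-⊕-↑ˡ G H label i ⟩
    wt G (label ∘ (_↑ˡ k)) i         ≡⟨ wt-cong G (cong suc ∘ toℕ-blockwise-↑ˡ σ τ) i ⟩
    wt G (λ u → suc (toℕ (σ u))) i   ≡⟨ wt-σ i ⟩
    + 0                              ∎

  wt-right : ∀ j → wt (G ⊕ H) label (m ↑ʳ j) ≡ + 0
  wt-right j = begin
    wt (G ⊕ H) label (m ↑ʳ j)               ≡⟨ wt-⊕-↑ʳ G H label j ⟩
    wt H (label ∘ (m ↑ʳ_)) j                 ≡⟨ wt-cong H (λ u → trans (cong suc (toℕ-blockwise-↑ʳ σ τ u)) (sym (ℕ.+-suc m _))) j ⟩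
    wt H (λ u → m ℕ.+ suc (toℕ (τ u))) j     ≡⟨ wt-shift-balanced H balanced m _ j ⟩
    wt H (λ u → suc (toℕ (τ u))) j           ≡⟨ wt-τ j ⟩
    + 0                                      ∎

theorem5 : (G₁ : Digraph) → (Gs : List Digraph) → DDMOG G₁
    → All (λ H → DDMOG H × ImbZero H) Gs → DDMOG (bigUnion G₁ Gs)
theorem5 G₁ []       G₁-ddm []                           = G₁-ddm
theorem5 G₁ (H ∷ Hs) G₁-ddm ((H-ddm , H-balanced) ∷ Hs-ok) =
  theorem5 (G₁ ⊕ H) Hs (⊕-DDMOG G₁ H G₁-ddm H-ddm H-balanced) Hs-ok
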